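{- There exists a $C_4$-free graph which is not Kempe connected.
   Context: All graphs are finite and simple. $C_4$ is the cycle on four vertices; $G$ is $C_4$-free if no induced subgraph of $G$ is isomorphic to $C_4$. A $k$-colouring of $G$ is a proper colouring $V(G)\to\{1,\dots,k\}$; $\mathcal{C}_k(G)$ is the set of all $k$-colourings and $\chi(G)$ the chromatic number. A Kempe chain (for a colouring and two colours $a,b$) is a connected component of the subgraph induced by the vertices coloured $a$ or $b$; a Kempe swap interchanges $a$ and $b$ on one Kempe chain. Two colourings are Kempe equivalent if each can be obtained from the other by a sequence of Kempe swaps; a set of colourings forms a Kempe class if its members are pairwise Kempe equivalent. $G$ is Kempe connected if $\mathcal{C}_k(G)$ forms a Kempe class for every $k\ge\chi(G)$. -}

module Defs where

open import Data.Nat using (ℕ; _≤_; _<_)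
open import Data.Fin using (Fin)
open import Data.Fin.Properties using () renaming (_≟_ to _≟ᶠ_)
open import Data.Product using (Σ; _×_; ∃; ∃-syntax; _,_)
open import Data.Sum using (_⊎_)
open import Relation.Nullary using (¬_; Dec; yes; no)
open import Relation.Binary.PropositionalEquality using (_≡_; _≢_)
open import Relation.Binary.Construct.Closure.ReflexiveTransitive using (Star)

record Graph : Set₁ where
  field
    n     : ℕ
    Adj   : Fin n → Fin n → Set
    sym   : ∀ {u v} → Adj u v → Adj v u
    irrefl : ∀ {u} → ¬ Adj u u
    dec   : ∀ u v → Dec (Adj u v)
open Graph public

InducedC4 : Graph → Set
InducedC4 G = Σ (Fin (n G)) λ a → Σ (Fin (n G)) λ b → Σ (Fin (n G)) λ c → Σ (Fin (n G)) λ d →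
  (a ≢ b × a ≢ c × a ≢ d × b ≢ c × b ≢ d × c ≢ d) ×
  (Adj G a b × Adj G b c × Adj G c d × Adj G d a) ×
  (¬ Adj G a c × ¬ Adj G b d)

C4Free : Graph → Set
C4Free G = ¬ InducedC4 G

record Colouring (G : Graph) (k : ℕ) : Set where
  constructor colouring
  field
    col    : Fin (n G) → Fin k
    proper : ∀ {u v} → Adj G u v → col u ≢ col v
open Colouring public

IsChromaticNumber : Graph → ℕ → Set
IsChromaticNumber G m = Colouring G m × (∀ j → j < m → ¬ Colouring G j)

swapCol : ∀ {k} → Fin k → Fin k → Fin k → Fin k
swapCol a b x with x ≟ᶠ a
... | yes _ = b
... | no _ with x ≟ᶠ b
...   | yes _ = a
...   | no _  = x

InAB : ∀ {G : Graph} {k} → (Fin (n G) → Fin k) → Fin k → Fin k → Fin (n G) → Set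
InAB f a b u = f u ≡ a ⊎ f u ≡ b

data InChain (G : Graph) {k : ℕ} (f : Fin (n G) → Fin k) (a b : Fin k) (v : Fin (n G))
     : Fin (n G) → Set where
  here : InAB {G} f a b v → InChain G f a b v v
  step : ∀ {u w} → InChain G f a b v u → Adj G u w → InAB {G} f a b w → InChain G f a b v w

KempeSwap : ∀ {G : Graph} {k} → Colouring G k → Colouring G k → Set
KempeSwap {G} {k} α β = Σ (Fin k) λ a → Σ (Fin k) λ b → Σ (Fin (n G)) λ v →
  InAB {G} (col α) a b v ×
  (∀ u → (InChain G (col α) a b v u → col β u ≡ swapCol a b (col α u)) ×
         (¬ InChain G (col α) a b v u → col β u ≡ col α u))

KempeEquivalent : ∀ {G : Graph} {k} → Colouring G k → Colouring G k → Set
KempeEquivalent {G} {k} = Star (KempeSwap {G} {k})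

KempeClass : Graph → ℕ → Set
KempeClass G k = (α β : Colouring G k) → KempeEquivalent α β

KempeConnected : Graph → Set
KempeConnected G = ∀ k → (∃[ m ] (IsChromaticNumber G m × m ≤ k)) → KempeClass G k

-- Take nine vertices in three independent triples, such that any two triples
-- induce a path on six vertices. If a 3-colouring γ is the class colouring
-- with its colours permuted, then for a ≢ b the vertices coloured a or b form
-- the union of two triples, which is connected; so every {a,b}-Kempe chain of
-- γ is the whole {a,b}-coloured subgraph, and the swap just permutes the
-- colours once more. Hence every colouring Kempe equivalent to the class
-- colouring is constant on the triples, but this graph also has a 3-colouring
-- that is not.
module Submission where

open import Defs hiding (sym)
open import Data.Product using (Σ; _×_; _,_; proj₁; proj₂)
open import Data.Product.Properties using (≡-dec)
open import Data.Sum using (_⊎_; inj₁; inj₂; swap)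
open import Data.Nat using (ℕ; _<_)
open import Data.Nat.Properties using (≤-refl)
open import Data.Fin using (Fin; _≟_)
open import Data.Fin.Patterns
open import Data.Fin.Properties using (all?; any?; pigeonhole; <⇒≢)
import Data.Fin.Permutation.Components as PC
open import Data.Fin.Permutation using (Permutation′; _⟨$⟩ʳ_; _⟨$⟩ˡ_; inverseˡ; inverseʳ; id; _∘ₚ_; transpose)
open import Data.List using (List; []; _∷_; _++_; zip; drop)
open import Data.List.Relation.Unary.All as All using (All; []; _∷_)
open import Data.List.Relation.Unary.Any using (here; there)
open import Data.List.Relation.Unary.Linked using (Linked; [-]; _∷_; linked?)
open import Data.List.Membership.Propositional using (_∈_)
import Data.List.Membership.DecPropositional as DecMembership
open import Data.Vec using (lookup) renaming (_∷_ to _∷ᵛ_; [] to []ᵛ)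
open import Function using (_∘_)
open import Relation.Nullary using (¬_; Dec; yes; no; contradiction)
open import Relation.Nullary.Decidable using (¬?; _×-dec_; _⊎-dec_; _→-dec_; from-yes; from-no; decidable-stable)
open import Relation.Binary.PropositionalEquality using (_≡_; _≢_; refl; sym; trans; cong; subst; module ≡-Reasoning)
open import Relation.Binary.Construct.Closure.ReflexiveTransitive using (Star; ε; _◅_; _◅◅_; reverse)

module _ {k : ℕ} where

  swapCol≗transpose : ∀ (a b x : Fin k) → swapCol a b x ≡ PC.transpose a b x
  swapCol≗transpose a b x with x ≟ a
  ... | yes _ = refl
  ... | no _ with x ≟ b
  ...   | yes _ = refl
  ...   | no _ = refl

  swapCol-same : ∀ (a x : Fin k) → swapCol a a x ≡ x
  swapCol-same a x with x ≟ a
  ... | yes x≡a = sym x≡a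
  ... | no _ with x ≟ a
  ...   | yes x≡a = sym x≡a
  ...   | no _ = refl

  swapCol-fixes : ∀ {a b x : Fin k} → x ≢ a → x ≢ b → swapCol a b x ≡ x
  swapCol-fixes {a} {b} {x} x≢a x≢b with x ≟ a
  ... | yes x≡a = contradiction x≡a x≢a
  ... | no _ with x ≟ b
  ...   | yes x≡b = contradiction x≡b x≢b
  ...   | no _ = refl

module _ (G : Graph) where

  Vertex : Set
  Vertex = Fin (n G)

  EdgeIn : (Vertex → Set) → Vertex → Vertex → Set
  EdgeIn S u w = S u × Adj G u w × S w

  ConnectedOn : (Vertex → Set) → Set
  ConnectedOn S = ∀ {u w} → S u → S w → Star (EdgeIn S) u w

  IsTrailThrough : (Vertex → Set) → List Vertex → Set
  IsTrailThrough S xs = Linked (Adj G) xs × All S xs × (∀ x → S x → x ∈ xs)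

  isTrailThrough? : ∀ {S} → (∀ x → Dec (S x)) → ∀ xs → Dec (IsTrailThrough S xs)
  isTrailThrough? S? xs = linked? (dec G) xs ×-dec All.all? S? xs ×-dec all? λ x → S? x →-dec (x ∈? xs)
    where open DecMembership _≟_ using (_∈?_)

  EdgeIn-sym : ∀ {S} {u w} → EdgeIn S u w → EdgeIn S w u
  EdgeIn-sym (Su , uw , Sw) = Sw , Graph.sym G uw , Su

  trail⇒connectedOn : ∀ {S} xs → IsTrailThrough S xs → ConnectedOn S
  trail⇒connectedOn [] (_ , _ , covers) Su _ with covers _ Su
  ... | ()
  trail⇒connectedOn {S} (y ∷ ys) (linked , inS , covers) Su Sw =
    reverse EdgeIn-sym (walkFromHead linked inS (covers _ Su)) ◅◅ walkFromHead linked inS (covers _ Sw)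
    where
      walkFromHead : ∀ {y ys x} → Linked (Adj G) (y ∷ ys) → All S (y ∷ ys) → x ∈ y ∷ ys → Star (EdgeIn S) y x
      walkFromHead _ _ (here refl) = ε
      walkFromHead [-] _ (there ())
      walkFromHead (yz ∷ linked) (Sy ∷ inS@(Sz ∷ _)) (there x∈) = (Sy , yz , Sz) ◅ walkFromHead linked inS x∈

  inducedC4? : Dec (InducedC4 G)
  inducedC4? =
    any? λ a → any? λ b → any? λ c → any? λ d →
      (¬? (a ≟ b) ×-dec ¬? (a ≟ c) ×-dec ¬? (a ≟ d) ×-dec ¬? (b ≟ c) ×-dec ¬? (b ≟ d) ×-dec ¬? (c ≟ d))
      ×-dec (dec G a b ×-dec dec G b c ×-dec dec G c d ×-dec dec G d a)
      ×-dec (¬? (dec G a c) ×-dec ¬? (dec G b d))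

  Proper : ∀ {k} → (Vertex → Fin k) → Set
  Proper f = ∀ u v → Adj G u v → f u ≢ f v

  proper? : ∀ {k} (f : Vertex → Fin k) → Dec (Proper f)
  proper? f = all? λ u → all? λ v → dec G u v →-dec ¬? (f u ≟ f v)

  colouringOf : ∀ {k} (f : Vertex → Fin k) → Proper f → Colouring G k
  colouringOf f proper = colouring f λ {u} {v} → proper u v

  clique⇒noColouring : ∀ {m j} (K : Fin m → Vertex) → (∀ i i′ → i ≢ i′ → Adj G (K i) (K i′)) →
                       j < m → ¬ Colouring G j
  clique⇒noColouring K clique j<m γ with i , i′ , i<i′ , same ← pigeonhole j<m (col γ ∘ K) =
    proper γ (clique i i′ (<⇒≢ i<i′)) same

module _ {G : Graph} {k : ℕ} where

  Among : Fin k → Fin k → Fin k → Set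
  Among a b c = c ≡ a ⊎ c ≡ b

  otherColour : ∀ {a b c} → a ≢ b → Among a b c → Σ (Fin k) λ d → Among a b d × d ≢ c
  otherColour a≢b (inj₁ refl) = _ , inj₂ refl , a≢b ∘ sym
  otherColour a≢b (inj₂ refl) = _ , inj₁ refl , a≢b

  chain-end : ∀ {f : Vertex G → Fin k} {a b v u} → InChain G f a b v u → Among a b (f u)
  chain-end (here ab) = ab
  chain-end (step _ _ ab) = ab

  chain-extend : ∀ {f : Vertex G → Fin k} {a b S v u w} → (∀ {x} → S x → Among a b (f x)) →
                 InChain G f a b v u → Star (EdgeIn G S) u w → InChain G f a b v w
  chain-extend S⊆ chain ε = chain
  chain-extend S⊆ chain ((_ , uw , Sw) ◅ walk) = chain-extend S⊆ (step chain uw (S⊆ Sw)) walk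

  SwapsChain : (γ δ : Colouring G k) (a b : Fin k) (v : Vertex G) → Set
  SwapsChain γ δ a b v =
    ∀ u → (InChain G (col γ) a b v u → col δ u ≡ swapCol a b (col γ u)) ×
          (¬ InChain G (col γ) a b v u → col δ u ≡ col γ u)

  module _ {γ δ : Colouring G k} {a b v} (swaps : SwapsChain γ δ a b v) where

    -- Chain membership need not be decidable, but the conclusion is, so it is stable.
    trivialSwap-transposes : a ≡ b → ∀ u → col δ u ≡ swapCol a b (col γ u)
    trivialSwap-transposes refl u = decidable-stable (col δ u ≟ swapCol a a (col γ u)) λ δu≢ →
      δu≢ (trans (proj₂ (swaps u) (δu≢ ∘ proj₁ (swaps u))) (sym (swapCol-same a _)))

    spanningSwap-transposes : (∀ u → Among a b (col γ u) → InChain G (col γ) a b v u) →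
                              ∀ u → col δ u ≡ swapCol a b (col γ u)
    spanningSwap-transposes spans u with (col γ u ≟ a) ⊎-dec (col γ u ≟ b)
    ... | yes ab = proj₁ (swaps u) (spans u ab)
    ... | no ¬ab = trans (proj₂ (swaps u) (¬ab ∘ chain-end))
                         (sym (swapCol-fixes (¬ab ∘ inj₁) (¬ab ∘ inj₂)))

  Relabelling : Colouring G k → Colouring G k → Set
  Relabelling α γ = Σ (Permutation′ k) λ π → ∀ u → col γ u ≡ π ⟨$⟩ʳ col α u

  ClassUnion : Colouring G k → Fin k → Fin k → Vertex G → Set
  ClassUnion α i j x = col α x ≡ i ⊎ col α x ≡ j

  ClassPairsConnected : Colouring G k → Set
  ClassPairsConnected α = ∀ {i j} → i ≢ j → ConnectedOn G (ClassUnion α i j)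

  module _ {α γ : Colouring G k} (π : Permutation′ k) (γ≡ : ∀ u → col γ u ≡ π ⟨$⟩ʳ col α u) where

    relabelling-respects : ∀ {u w} → col α u ≡ col α w → col γ u ≡ col γ w
    relabelling-respects {u} {w} eq = trans (γ≡ u) (trans (cong (π ⟨$⟩ʳ_) eq) (sym (γ≡ w)))

    relabelling-reflects : ∀ {u w} → col γ u ≡ col γ w → col α u ≡ col α w
    relabelling-reflects {u} {w} eq = begin
      col α u                 ≡⟨ inverseˡ π ⟨
      π ⟨$⟩ˡ (π ⟨$⟩ʳ col α u) ≡⟨ cong (π ⟨$⟩ˡ_) (trans (sym (γ≡ u)) (trans eq (γ≡ w))) ⟩
      π ⟨$⟩ˡ (π ⟨$⟩ʳ col α w) ≡⟨ inverseˡ π ⟩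
      col α w                 ∎
      where open ≡-Reasoning

    classUnion-chain : ∀ {a b i j v u} → ClassPairsConnected α → i ≢ j →
                       Among a b (π ⟨$⟩ʳ i) → Among a b (π ⟨$⟩ʳ j) →
                       ClassUnion α i j v → ClassUnion α i j u → InChain G (col γ) a b v u
    classUnion-chain {a} {b} {i} {j} connected i≢j πi πj v∈ u∈ =
      chain-extend coloured (here (coloured v∈)) (connected i≢j v∈ u∈)
      where
        coloured : ∀ {x} → ClassUnion α i j x → Among a b (col γ x)
        coloured {x} (inj₁ refl) = subst (Among a b) (sym (γ≡ x)) πi
        coloured {x} (inj₂ refl) = subst (Among a b) (sym (γ≡ x)) πj

    relabelling-spans : ∀ {a b v} → ClassPairsConnected α → a ≢ b → Among a b (col γ v) →
                        ∀ u → Among a b (col γ u) → InChain G (col γ) a b v u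
    relabelling-spans {a} {b} {v} connected a≢b abv u abu with col γ u ≟ col γ v
    ... | no γu≢γv =
      classUnion-chain connected (γu≢γv ∘ sym ∘ relabelling-respects)
        (subst (Among a b) (γ≡ v) abv) (subst (Among a b) (γ≡ u) abu) (inj₁ refl) (inj₂ refl)
    ... | yes γu≡γv with d , abd , d≢γv ← otherColour a≢b abv =
      classUnion-chain connected v∉class
        (subst (Among a b) (γ≡ v) abv) (subst (Among a b) (sym (inverseʳ π)) abd)
        (inj₁ refl) (inj₁ (relabelling-reflects γu≡γv))
      where
        v∉class : col α v ≢ π ⟨$⟩ˡ d
        v∉class eq = d≢γv (trans (sym (inverseʳ π)) (trans (cong (π ⟨$⟩ʳ_) (sym eq)) (sym (γ≡ v))))

  module _ {α : Colouring G k} (connected : ClassPairsConnected α) where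

    kempeSwap-relabelling : ∀ {γ δ} → Relabelling α γ → KempeSwap γ δ → Relabelling α δ
    kempeSwap-relabelling {γ} {δ} (π , γ≡) (a , b , v , abv , swaps) = π ∘ₚ transpose a b , λ u → begin
      col δ u                           ≡⟨ transposes u ⟩
      swapCol a b (col γ u)             ≡⟨ swapCol≗transpose a b (col γ u) ⟩
      PC.transpose a b (col γ u)        ≡⟨ cong (PC.transpose a b) (γ≡ u) ⟩
      PC.transpose a b (π ⟨$⟩ʳ col α u) ∎
      where
        open ≡-Reasoning
        transposes : ∀ u → col δ u ≡ swapCol a b (col γ u)
        transposes with a ≟ b
        ... | yes a≡b = trivialSwap-transposes {γ = γ} {δ} swaps a≡b
        ... | no a≢b = spanningSwap-transposes {γ = γ} {δ} swaps
                         (relabelling-spans {α = α} {γ} π γ≡ connected a≢b abv)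

    kempeEquivalent-relabelling : ∀ {γ δ} → Relabelling α γ → KempeEquivalent γ δ → Relabelling α δ
    kempeEquivalent-relabelling r ε = r
    kempeEquivalent-relabelling {γ} r (_◅_ {j = μ} first rest) =
      kempeEquivalent-relabelling (kempeSwap-relabelling {γ} {μ} r first) rest

    kempeClass⊆relabellings : ∀ {γ} → KempeEquivalent α γ → Relabelling α γ
    kempeClass⊆relabellings = kempeEquivalent-relabelling {α} (id , λ _ → refl)

fromEdges : ∀ {m} (es : List (Fin m × Fin m)) → All (λ e → proj₁ e ≢ proj₂ e) es → Graph
fromEdges {m} es loopless = record
  { n      = m
  ; Adj    = λ u v → (u , v) ∈ es ⊎ (v , u) ∈ es
  ; sym    = swap
  ; irrefl = λ { (inj₁ uu) → All.lookup loopless uu refl ; (inj₂ uu) → All.lookup loopless uu refl }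
  ; dec    = λ u v → ((u , v) ∈? es) ⊎-dec ((v , u) ∈? es)
  }
  where open DecMembership (≡-dec _≟_ _≟_) using (_∈?_)

pathEdges : ∀ {A : Set} → List A → List (A × A)
pathEdges xs = zip xs (drop 1 xs)

-- The classes are {0,1,2}, {3,4,5} and {6,7,8}.
trail : Fin 3 → Fin 3 → List (Fin 9)
trail 0F 1F = 5F ∷ 0F ∷ 4F ∷ 1F ∷ 3F ∷ 2F ∷ []
trail 0F 2F = 7F ∷ 2F ∷ 6F ∷ 0F ∷ 8F ∷ 1F ∷ []
trail 1F 2F = 3F ∷ 7F ∷ 5F ∷ 8F ∷ 4F ∷ 6F ∷ []
trail 1F 0F = trail 0F 1F
trail 2F 0F = trail 0F 2F
trail 2F 1F = trail 1F 2F
trail _  _  = []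

edges : List (Fin 9 × Fin 9)
edges = pathEdges (trail 0F 1F) ++ pathEdges (trail 0F 2F) ++ pathEdges (trail 1F 2F)

G : Graph
G = fromEdges edges (from-yes (All.all? (λ e → ¬? (proj₁ e ≟ proj₂ e)) edges))

c4Free : C4Free G
c4Free = from-no (inducedC4? G)

classColouring : Colouring G 3
classColouring = colouringOf G f (from-yes (proper? G f))
  where f = lookup (0F ∷ᵛ 0F ∷ᵛ 0F ∷ᵛ 1F ∷ᵛ 1F ∷ᵛ 1F ∷ᵛ 2F ∷ᵛ 2F ∷ᵛ 2F ∷ᵛ []ᵛ)

mixedColouring : Colouring G 3
mixedColouring = colouringOf G f (from-yes (proper? G f))
  where f = lookup (0F ∷ᵛ 0F ∷ᵛ 1F ∷ᵛ 2F ∷ᵛ 1F ∷ᵛ 1F ∷ᵛ 2F ∷ᵛ 0F ∷ᵛ 2F ∷ᵛ []ᵛ)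

classPairsConnected : ClassPairsConnected classColouring
classPairsConnected {i} {j} i≢j = trail⇒connectedOn G (trail i j) (trails i j i≢j)
  where
    trails : ∀ i j → i ≢ j → IsTrailThrough G (ClassUnion classColouring i j) (trail i j)
    trails = from-yes (all? λ i → all? λ j → ¬? (i ≟ j) →-dec
               isTrailThrough? G (λ x → (col classColouring x ≟ i) ⊎-dec (col classColouring x ≟ j)) (trail i j))

mixed-notRelabelling : ¬ Relabelling classColouring mixedColouring
mixed-notRelabelling (π , eq)
  with () ← relabelling-respects {α = classColouring} {mixedColouring} π eq {0F} {2F} refl

chromaticNumber : IsChromaticNumber G 3
chromaticNumber = classColouring , λ j j<3 → clique⇒noColouring G triangle (from-yes (clique? triangle)) j<3
  where
    triangle : Fin 3 → Fin 9
    triangle = lookup (0F ∷ᵛ 4F ∷ᵛ 8F ∷ᵛ []ᵛ)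
    clique? : ∀ (K : Fin 3 → Fin 9) → Dec (∀ i i′ → i ≢ i′ → Adj G (K i) (K i′))
    clique? K = all? λ i → all? λ i′ → ¬? (i ≟ i′) →-dec dec G (K i) (K i′)

lemma3 : Σ Graph λ G → C4Free G × ¬ KempeConnected G
lemma3 = G , c4Free , λ kempeConnected →
  mixed-notRelabelling (kempeClass⊆relabellings classPairsConnected
    (kempeConnected 3 (3 , chromaticNumber , ≤-refl) classColouring mixedColouring))
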